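{- Let $s$ be a positive integer, let $\mathcal F$ be a hypergraph on vertex set $V$, and let $i$ be an integer with $0<i<|V|$ such that $\wp(\mathcal F,i)\le\frac{|\mathcal F|}{2^s|V|^{s-1}}$. Then there are at least $i^s$ tuples $U\in V^s$ with $|\mathcal F(U)|\ge\frac{|\mathcal F|}{(2|V|)^s}$.
   Context: For a hypergraph $\mathcal F$ on $V$ and integer $i$, $\wp(\mathcal F,i)=\max_{I\subseteq V,|I|=i}|\{e\in\mathcal F: e\subseteq I\}|$. For $I\subseteq V$, the link of $I$ is the hypergraph $\mathcal F(I)$ on $V\setminus I$ with edges $\{e\setminus I: I\subseteq e\in\mathcal F\}$. For a tuple $U$ of vertices, $\mathcal F(U)$ denotes $\mathcal F(I)$ where $I$ is the set of distinct vertices appearing in $U$. -}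

module Defs where

open import Data.Nat using (ℕ; zero; suc; _⊔_; _≟_)
open import Data.Bool using (true; false)
open import Data.List using (List; []; _∷_; map; filter; length; foldr; _++_)
open import Data.Vec using (Vec; []; _∷_)
open import Data.Fin using (Fin)
open import Data.Fin.Subset using (Subset; ∣_∣; _⊆_; _─_; _∪_; ⁅_⁆; ⊥)
open import Data.Fin.Subset.Properties using (_⊆?_)
open import Data.List.Relation.Unary.Unique.Propositional using (Unique)

record Hypergraph (n : ℕ) : Set where
  field
    edges  : List (Subset n)
    unique : Unique edges
open Hypergraph public

∣_∣ₑ : ∀ {n} → Hypergraph n → ℕ
∣ F ∣ₑ = length (edges F)

allSubsets : (n : ℕ) → List (Subset n)
allSubsets zero    = [] ∷ []
allSubsets (suc n) = map (false ∷_) (allSubsets n) ++ map (true ∷_) (allSubsets n)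

edgesInside : ∀ {n} → List (Subset n) → Subset n → ℕ
edgesInside es I = length (filter (λ e → e ⊆? I) es)

℘ : ∀ {n} → Hypergraph n → ℕ → ℕ
℘ {n} F i =
  foldr _⊔_ 0 (map (edgesInside (edges F)) (filter (λ I → ∣ I ∣ ≟ i) (allSubsets n)))

linkEdges : ∀ {n} → Hypergraph n → Subset n → List (Subset n)
linkEdges F I = map (λ e → e ─ I) (filter (λ e → I ⊆? e) (edges F))

-- |F(I)|.  (The map e ↦ e ∖ I is injective on edges containing I, so the
-- list above is duplicate-free and its length is the number of link edges.)
∣link∣ : ∀ {n} → Hypergraph n → Subset n → ℕ
∣link∣ F I = length (linkEdges F I)

vertexSet : ∀ {n s} → Vec (Fin n) s → Subset n
vertexSet []       = ⊥
vertexSet (x ∷ xs) = ⁅ x ⁆ ∪ vertexSet xs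

-- Call v heavy for W when |F(W ∪ {v})| · 2|V| ≥ |F(W)|. If fewer than i vertices were heavy, put
-- them in a set I of size i: every edge through W lies inside I or contains some v ∉ I, so
-- |F(W)| ≤ ℘(F,i) + Σ_{v∉I} |F(W ∪ {v})| < ℘(F,i) + |F(W)|/2, i.e. |F(W)| < 2℘(F,i).
-- After l < s heavy choices starting from W = ∅ we still have |F| ≤ |F(W)| (2|V|)^l, and then
-- |F(W)| < 2℘(F,i) contradicts |F| ≥ ℘(F,i) 2^s |V|^(s-1). Hence each of the s steps offers at
-- least i heavy vertices, and the i^s resulting tuples U satisfy |F| ≤ |F(U)| (2|V|)^s.
module Submission where

open import Defs
open import Data.Nat using (ℕ; zero; suc; _+_; _*_; _^_; _≤_; _<_; _∸_; _⊔_; z≤n; s≤s; _≤?_)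
open import Data.Nat.Properties
open import Data.Nat.Solver using (module +-*-Solver)
open import Algebra.Properties.CommutativeSemigroup +-commutativeSemigroup using (x∙yz≈y∙xz)
open import Algebra.Properties.CommutativeSemigroup *-commutativeSemigroup using ()
  renaming (interchange to *-interchange)
open import Data.Fin using (Fin; zero; suc)
import Data.Fin.Properties as Fin
open import Data.Fin.Subset
  using (Subset; inside; outside; ∣_∣; _⊆_; _∈_; _∪_; _∩_; ∁; ⁅_⁆; ⊥; ⊤; Nonempty)
open import Data.Fin.Subset.Properties
  using (_⊆?_; nonempty?; x∈p∩q⁺; x∈p∩q⁻; x∈p∪q⁻; x∉∁p⇒x∈p; x∈∁p⇒x∉p; x∈⁅y⁆⇒x≡y;
         ⊥⊆; ⊆⊤; ∣⊤∣≡n; ∣p∣≤n; ∣∁p∣≡n∸∣p∣; out⊆; in⊆in; ∪-assoc; ∪-comm; ∪-identityˡ; ∪-identityʳ)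
open import Data.Vec as Vec using (Vec; []; _∷_; here; there; tabulate)
open import Data.Vec.Properties using (lookup∘tabulate; lookup⇒[]=; []=⇒lookup; ∷-injectiveʳ)
open import Data.List using (List; []; _∷_; map; filter; length; foldr; _++_)
import Data.List.Properties as List
open import Data.List.Relation.Unary.All as All using (All; []; _∷_)
import Data.List.Relation.Unary.All.Properties as All
open import Data.List.Relation.Unary.Any as Any using ()
open import Data.List.Relation.Unary.Unique.Propositional using (Unique; []; _∷_)
import Data.List.Relation.Unary.Unique.Propositional.Properties as Unique
open import Data.List.Relation.Binary.Disjoint.Propositional using (Disjoint)
open import Data.List.Membership.Propositional using () renaming (_∈_ to _∈ₗ_)
open import Data.List.Membership.Propositional.Properties using (∈-map⁺; ∈-map⁻; ∈-++⁺ˡ; ∈-++⁺ʳ; ∈-filter⁺)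
open import Data.Product using (Σ; ∃-syntax; _×_; _,_; proj₁)
open import Data.Sum using (_⊎_; inj₁; inj₂)
open import Level using (Level)
open import Relation.Nullary using (yes; no; does; contradiction)
open import Relation.Unary using (Pred; Decidable)
open import Relation.Binary.PropositionalEquality

private
  variable
    a ℓ : Level
    A : Set a
    n : ℕ

module _ {P : Pred A ℓ} (P? : Decidable P) where

  count : List A → ℕ
  count xs = length (filter P? xs)

  count-accept : ∀ {x xs} → P x → count (x ∷ xs) ≡ suc (count xs)
  count-accept px = cong length (List.filter-accept P? px)

  count-∷-≤ : ∀ x xs → count xs ≤ count (x ∷ xs)
  count-∷-≤ x xs with P? x
  ... | yes _ = n≤1+n _
  ... | no  _ = ≤-refl

sumOver : Subset n → (Fin n → ℕ) → ℕ
sumOver []            f = 0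
sumOver (inside  ∷ p) f = f zero + sumOver p (λ v → f (suc v))
sumOver (outside ∷ p) f = sumOver p (λ v → f (suc v))

sumOver-mono-≤ : ∀ (p : Subset n) {f g} → (∀ {v} → v ∈ p → f v ≤ g v) →
                 sumOver p f ≤ sumOver p g
sumOver-mono-≤ []            f≤g = z≤n
sumOver-mono-≤ (inside  ∷ p) f≤g = +-mono-≤ (f≤g here) (sumOver-mono-≤ p (λ v∈p → f≤g (there v∈p)))
sumOver-mono-≤ (outside ∷ p) f≤g = sumOver-mono-≤ p (λ v∈p → f≤g (there v∈p))

sumOver-mono-< : ∀ (p : Subset n) {f g x} → (∀ {v} → v ∈ p → f v ≤ g v) →
                 x ∈ p → f x < g x → sumOver p f < sumOver p g
sumOver-mono-< (inside  ∷ p) f≤g here fx<gx =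
  +-mono-<-≤ fx<gx (sumOver-mono-≤ p (λ v∈p → f≤g (there v∈p)))
sumOver-mono-< (inside  ∷ p) f≤g (there x∈p) fx<gx =
  +-mono-≤-< (f≤g here) (sumOver-mono-< p (λ v∈p → f≤g (there v∈p)) x∈p fx<gx)
sumOver-mono-< (outside ∷ p) f≤g (there x∈p) fx<gx =
  sumOver-mono-< p (λ v∈p → f≤g (there v∈p)) x∈p fx<gx

sumOver-const : ∀ (p : Subset n) c → sumOver p (λ _ → c) ≡ ∣ p ∣ * c
sumOver-const []            c = refl
sumOver-const (inside  ∷ p) c = cong (c +_) (sumOver-const p c)
sumOver-const (outside ∷ p) c = sumOver-const p c

sumOver-suc : ∀ (p : Subset n) f → sumOver p (λ v → suc (f v)) ≡ ∣ p ∣ + sumOver p f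
sumOver-suc []            f = refl
sumOver-suc (inside  ∷ p) f =
  cong suc (trans (cong (f zero +_) (sumOver-suc p (λ v → f (suc v)))) (x∙yz≈y∙xz (f zero) ∣ p ∣ _))
sumOver-suc (outside ∷ p) f = sumOver-suc p (λ v → f (suc v))

sumOver-*ʳ : ∀ (p : Subset n) f c → sumOver p (λ v → f v * c) ≡ sumOver p f * c
sumOver-*ʳ []            f c = refl
sumOver-*ʳ (inside  ∷ p) f c =
  trans (cong (f zero * c +_) (sumOver-*ʳ p (λ v → f (suc v)) c)) (sym (*-distribʳ-+ c (f zero) _))
sumOver-*ʳ (outside ∷ p) f c = sumOver-*ʳ p (λ v → f (suc v)) c

module _ {p q r} {P : Pred A p} {Q : Pred A q} {R : Fin n → Pred A r}
         (P? : Decidable P) (Q? : Decidable Q) (R? : ∀ v → Decidable (R v)) (I : Subset n)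
         (cover : ∀ {x} → P x → Q x ⊎ ∃[ v ] (v ∈ I × R v x)) where

  private
    sumOver-count-∷-≤ : ∀ x xs →
      sumOver I (λ v → count (R? v) xs) ≤ sumOver I (λ v → count (R? v) (x ∷ xs))
    sumOver-count-∷-≤ x xs = sumOver-mono-≤ I (λ {v} _ → count-∷-≤ (R? v) x xs)

  count-≤-union : ∀ xs → count P? xs ≤ count Q? xs + sumOver I (λ v → count (R? v) xs)
  count-≤-union []       = z≤n
  count-≤-union (x ∷ xs) with P? x
  ... | no _ = begin
    count P? xs                                     ≤⟨ count-≤-union xs ⟩
    count Q? xs + sumOver I (λ v → count (R? v) xs) ≤⟨ +-mono-≤ (count-∷-≤ Q? x xs) (sumOver-count-∷-≤ x xs) ⟩
    count Q? (x ∷ xs) + sumOver I (λ v → count (R? v) (x ∷ xs)) ∎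
    where open ≤-Reasoning
  ... | yes px with cover px
  ...   | inj₁ qx = begin
    suc (count P? xs)                                     ≤⟨ s≤s (count-≤-union xs) ⟩
    suc (count Q? xs) + sumOver I (λ v → count (R? v) xs) ≡⟨ cong (_+ _) (count-accept Q? qx) ⟨
    count Q? (x ∷ xs) + sumOver I (λ v → count (R? v) xs) ≤⟨ +-monoʳ-≤ _ (sumOver-count-∷-≤ x xs) ⟩
    count Q? (x ∷ xs) + sumOver I (λ v → count (R? v) (x ∷ xs)) ∎
    where open ≤-Reasoning
  ...   | inj₂ (w , w∈I , rwx) = begin
    suc (count P? xs)                                     ≤⟨ s≤s (count-≤-union xs) ⟩
    suc (count Q? xs + sumOver I (λ v → count (R? v) xs)) ≡⟨ +-suc _ _ ⟨
    count Q? xs + suc (sumOver I (λ v → count (R? v) xs)) ≤⟨ +-mono-≤ (count-∷-≤ Q? x xs) sum-grows ⟩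
    count Q? (x ∷ xs) + sumOver I (λ v → count (R? v) (x ∷ xs)) ∎
    where
    open ≤-Reasoning
    sum-grows : sumOver I (λ v → count (R? v) xs) < sumOver I (λ v → count (R? v) (x ∷ xs))
    sum-grows = sumOver-mono-< I (λ {v} _ → count-∷-≤ (R? v) x xs) w∈I
                  (≤-reflexive (sym (count-accept (R? w) rwx)))

⁅x⁆∪p⊆q : ∀ {x} {p q : Subset n} → x ∈ q → p ⊆ q → ⁅ x ⁆ ∪ p ⊆ q
⁅x⁆∪p⊆q {x = x} {p} x∈q p⊆q y∈ with x∈p∪q⁻ ⁅ x ⁆ p y∈
... | inj₁ y∈⁅x⁆ rewrite x∈⁅y⁆⇒x≡y x y∈⁅x⁆ = x∈q
... | inj₂ y∈p = p⊆q y∈p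

p⊆q⊎Nonempty[p∩∁q] : ∀ (p q : Subset n) → p ⊆ q ⊎ Nonempty (p ∩ ∁ q)
p⊆q⊎Nonempty[p∩∁q] p q with nonempty? (p ∩ ∁ q)
... | yes nonempty = inj₂ nonempty
... | no  empty    = inj₁ λ x∈p → x∉∁p⇒x∈p λ x∈∁q → empty (_ , x∈p∩q⁺ (x∈p , x∈∁q))

superset-of-size : ∀ (p : Subset n) {i} → ∣ p ∣ ≤ i → i ≤ n → ∃[ q ] (p ⊆ q × ∣ q ∣ ≡ i)
superset-of-size []            z≤n         z≤n      = [] , (λ ()) , refl
superset-of-size (inside  ∷ p) {suc i} (s≤s ∣p∣≤i) (s≤s i≤n)
  with q , p⊆q , ∣q∣≡i ← superset-of-size p ∣p∣≤i i≤n = inside ∷ q , in⊆in p⊆q , cong suc ∣q∣≡i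
superset-of-size {suc n} (outside ∷ p) {i} ∣p∣≤i i≤1+n with i ≤? n
... | yes i≤n with q , p⊆q , ∣q∣≡i ← superset-of-size p ∣p∣≤i i≤n = outside ∷ q , out⊆ p⊆q , ∣q∣≡i
... | no  i≰n = ⊤ , ⊆⊤ , trans (∣⊤∣≡n _) (≤-antisym (≰⇒> i≰n) i≤1+n)

module _ {P : Pred (Fin n) ℓ} (P? : Decidable P) where

  subsetOf : Subset n
  subsetOf = tabulate (λ v → does (P? v))

  ∈-subsetOf⁺ : ∀ {v} → P v → v ∈ subsetOf
  ∈-subsetOf⁺ {v} pv with P? v in eq
  ... | yes _ = lookup⇒[]= v subsetOf (trans (lookup∘tabulate _ v) (cong does eq))
  ... | no ¬pv = contradiction pv ¬pv

  ∈-subsetOf⁻ : ∀ {v} → v ∈ subsetOf → P v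
  ∈-subsetOf⁻ {v} v∈ with P? v in eq
  ... | yes pv = pv
  ... | no  _  with () ← trans (sym (cong does eq)) (trans (sym (lookup∘tabulate _ v)) ([]=⇒lookup v∈))

elements : Subset n → List (Fin n)
elements []            = []
elements (inside  ∷ p) = zero ∷ map suc (elements p)
elements (outside ∷ p) = map suc (elements p)

elements-unique : ∀ (p : Subset n) → Unique (elements p)
elements-unique []            = []
elements-unique (inside  ∷ p) =
  All.map⁺ (All.universal (λ _ ()) (elements p)) ∷ Unique.map⁺ Fin.suc-injective (elements-unique p)
elements-unique (outside ∷ p) = Unique.map⁺ Fin.suc-injective (elements-unique p)

length-elements : ∀ (p : Subset n) → length (elements p) ≡ ∣ p ∣
length-elements []            = refl
length-elements (inside  ∷ p) = cong suc (trans (List.length-map suc (elements p)) (length-elements p))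
length-elements (outside ∷ p) = trans (List.length-map suc (elements p)) (length-elements p)

elements-⊆ : ∀ (p : Subset n) → All (_∈ p) (elements p)
elements-⊆ []            = []
elements-⊆ (inside  ∷ p) = here ∷ All.map⁺ (All.map there (elements-⊆ p))
elements-⊆ (outside ∷ p) = All.map⁺ (All.map there (elements-⊆ p))

^-distribʳ-* : ∀ x y l → (x * y) ^ l ≡ x ^ l * y ^ l
^-distribʳ-* x y zero    = refl
^-distribʳ-* x y (suc l) = trans (cong (x * y *_) (^-distribʳ-* x y l)) (*-interchange x y (x ^ l) (y ^ l))

average⇒<2* : ∀ {a p S k n} → 0 < k → k ≤ n → a ≤ p + S → k + S * (2 * n) ≤ k * a → a < 2 * p
average⇒<2* {a} {p} {S} {k} {n} 0<k k≤n a≤p+S kS≤ka = *-cancelˡ-< n a (2 * p) (begin-strict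
  n * a      <⟨ m<m+n (n * a) 0<k ⟩
  n * a + k  ≤⟨ +-cancelʳ-≤ (n * a) _ _ doubled ⟩
  p * (2 * n) ≡⟨ solve 2 (λ p n → p :* (con 2 :* n) := n :* (con 2 :* p)) refl p n ⟩
  n * (2 * p) ∎)
  where
  open ≤-Reasoning
  open +-*-Solver
  doubled : (n * a + k) + n * a ≤ p * (2 * n) + n * a
  doubled = begin
    (n * a + k) + n * a         ≡⟨ solve 3 (λ n a k → (n :* a :+ k) :+ n :* a := a :* (con 2 :* n) :+ k) refl n a k ⟩
    a * (2 * n) + k             ≤⟨ +-monoˡ-≤ k (*-monoˡ-≤ (2 * n) a≤p+S) ⟩
    (p + S) * (2 * n) + k       ≡⟨ solve 4 (λ p S n k → (p :+ S) :* (con 2 :* n) :+ k := p :* (con 2 :* n) :+ (k :+ S :* (con 2 :* n))) refl p S n k ⟩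
    p * (2 * n) + (k + S * (2 * n)) ≤⟨ +-monoʳ-≤ (p * (2 * n)) (≤-trans kS≤ka (*-monoˡ-≤ a k≤n)) ⟩
    p * (2 * n) + n * a         ∎

level-bound : ∀ {m a p n l s} → 0 < n → suc l ≤ s → m ≤ a * (2 * n) ^ l → a < 2 * p →
              m < p * (2 ^ s * n ^ (s ∸ 1))
level-bound {m} {a} {p} {suc n} {l} {s} _ l<s m≤a*q a<2p = begin-strict
  m                         ≤⟨ m≤a*q ⟩
  a * q                     <⟨ m<n+m (a * q) (m^n>0 (2 * suc n) l) ⟩
  suc a * q                 ≤⟨ *-monoˡ-≤ q a<2p ⟩
  2 * p * q                 ≡⟨ cong (2 * p *_) (^-distribʳ-* 2 (suc n) l) ⟩
  2 * p * (2 ^ l * suc n ^ l) ≡⟨ solve 3 (λ p x y → con 2 :* p :* (x :* y) := p :* ((con 2 :* x) :* y)) refl p (2 ^ l) (suc n ^ l) ⟩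
  p * (2 ^ suc l * suc n ^ l) ≤⟨ *-monoʳ-≤ p (*-mono-≤ (^-monoʳ-≤ 2 l<s) (^-monoʳ-≤ (suc n) l≤s∸1)) ⟩
  p * (2 ^ s * suc n ^ (s ∸ 1)) ∎
  where
  open ≤-Reasoning
  open +-*-Solver
  q : ℕ
  q = (2 * suc n) ^ l
  l≤s∸1 : l ≤ s ∸ 1
  l≤s∸1 = ≤-trans (suc[m]≤n⇒m≤pred[n] l<s) (≤-reflexive (pred[m∸n]≡m∸[1+n] s 0))

prefix-union : ∀ {b k m} {P : A → Vec A k → Set b} (vs : List A) → Unique vs →
  All (λ v → Σ (List (Vec A k)) λ Ts → Unique Ts × m ≤ length Ts × All (P v) Ts) vs →
  Σ (List (Vec A (suc k))) λ Us → Unique Us × length vs * m ≤ length Us ×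
    All (λ U → Vec.head U ∈ₗ vs × P (Vec.head U) (Vec.tail U)) Us
prefix-union []       []            []  = [] , [] , z≤n , []
prefix-union (v ∷ vs) (v∉vs ∷ vs!) ((Ts , Ts! , m≤∣Ts∣ , good) ∷ families)
  with Us , Us! , ∣vs∣*m≤∣Us∣ , goodUs ← prefix-union vs vs! families =
  map (v ∷_) Ts ++ Us ,
  Unique.++⁺ (Unique.map⁺ ∷-injectiveʳ Ts!) Us! disjoint ,
  ≤-trans (+-mono-≤ m≤∣Ts∣ ∣vs∣*m≤∣Us∣) (≤-reflexive (sym length-Us′)) ,
  All.++⁺ (All.map⁺ (All.map (λ pT → Any.here refl , pT) good))
          (All.map (λ (v′∈vs , pU) → Any.there v′∈vs , pU) goodUs)
  where
  length-Us′ : length (map (v ∷_) Ts ++ Us) ≡ length Ts + length Us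
  length-Us′ = trans (List.length-++ (map (v ∷_) Ts)) (cong (_+ length Us) (List.length-map (v ∷_) Ts))
  disjoint : Disjoint (map (v ∷_) Ts) Us
  disjoint (U∈vTs , U∈Us) with _ , _ , refl ← ∈-map⁻ (v ∷_) U∈vTs =
    All.lookup v∉vs (proj₁ (All.lookup goodUs U∈Us)) refl

module _ {n i} (Good : ℕ → Subset n → Set)
  (branch : ∀ {k W} → Good (suc k) W →
    Σ (List (Fin n)) λ vs → Unique vs × i ≤ length vs × All (λ v → Good k (⁅ v ⁆ ∪ W)) vs) where

  tuples : ∀ k {W} → Good k W →
    Σ (List (Vec (Fin n) k)) λ Us → Unique Us × i ^ k ≤ length Us × All (λ U → Good 0 (vertexSet U ∪ W)) Us
  tuples zero    {W} g = [] ∷ [] , [] ∷ [] , ≤-refl , subst (Good 0) (sym (∪-identityˡ W)) g ∷ []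
  tuples (suc k) {W} g
    with vs , vs! , i≤∣vs∣ , good ← branch g
    with Us , Us! , ∣vs∣*i^k≤∣Us∣ , goodUs ← prefix-union vs vs! (All.map (λ {v} → tuples k {⁅ v ⁆ ∪ W}) good) =
    Us , Us! , ≤-trans (*-monoˡ-≤ (i ^ k) i≤∣vs∣) ∣vs∣*i^k≤∣Us∣ , All.map (λ {U} → regroup {U}) goodUs
    where
    regroup : ∀ {U : Vec (Fin n) (suc k)} → Vec.head U ∈ₗ vs × Good 0 (vertexSet (Vec.tail U) ∪ (⁅ Vec.head U ⁆ ∪ W)) →
              Good 0 (vertexSet U ∪ W)
    regroup {v ∷ T} (_ , good) = subst (Good 0) (sym reassociate) good
      where
      reassociate : (⁅ v ⁆ ∪ vertexSet T) ∪ W ≡ vertexSet T ∪ (⁅ v ⁆ ∪ W)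
      reassociate = trans (cong (_∪ W) (∪-comm ⁅ v ⁆ (vertexSet T))) (∪-assoc (vertexSet T) ⁅ v ⁆ W)

∈-allSubsets : ∀ (p : Subset n) → p ∈ₗ allSubsets n
∈-allSubsets []                    = Any.here refl
∈-allSubsets {suc n} (outside ∷ p) = ∈-++⁺ˡ (∈-map⁺ (outside ∷_) (∈-allSubsets p))
∈-allSubsets {suc n} (inside  ∷ p) =
  ∈-++⁺ʳ (map (outside ∷_) (allSubsets n)) (∈-map⁺ (inside ∷_) (∈-allSubsets p))

≤-foldr-⊔ : ∀ {x} xs → x ∈ₗ xs → x ≤ foldr _⊔_ 0 xs
≤-foldr-⊔ (y ∷ ys) (Any.here refl) = m≤m⊔n y _
≤-foldr-⊔ (y ∷ ys) (Any.there x∈ys) = ≤-trans (≤-foldr-⊔ ys x∈ys) (m≤n⊔m y _)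

edgesInside≤℘ : ∀ (F : Hypergraph n) {I i} → ∣ I ∣ ≡ i → edgesInside (edges F) I ≤ ℘ F i
edgesInside≤℘ F {I} {i} ∣I∣≡i =
  ≤-foldr-⊔ _ (∈-map⁺ (edgesInside (edges F)) (∈-filter⁺ (λ J → ∣ J ∣ ≟ i) (∈-allSubsets I) ∣I∣≡i))

module _ (F : Hypergraph n) where

  codegree : Subset n → ℕ
  codegree W = count (W ⊆?_) (edges F)

  ∣link∣≡codegree : ∀ W → ∣link∣ F W ≡ codegree W
  ∣link∣≡codegree W = List.length-map _ (filter (W ⊆?_) (edges F))

  codegree-⊥ : codegree ⊥ ≡ ∣ F ∣ₑ
  codegree-⊥ = cong length (List.filter-all (⊥ ⊆?_) (All.universal (λ _ {_} → ⊥⊆) (edges F)))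

  codegree-≤-inside+∑outside : ∀ W I →
    codegree W ≤ edgesInside (edges F) I + sumOver (∁ I) (λ v → codegree (⁅ v ⁆ ∪ W))
  codegree-≤-inside+∑outside W I =
    count-≤-union (W ⊆?_) (_⊆? I) (λ v → (⁅ v ⁆ ∪ W) ⊆?_) (∁ I) cover (edges F)
    where
    cover : ∀ {e} → W ⊆ e → e ⊆ I ⊎ ∃[ v ] (v ∈ ∁ I × ⁅ v ⁆ ∪ W ⊆ e)
    cover {e} W⊆e with p⊆q⊎Nonempty[p∩∁q] e I
    ... | inj₁ e⊆I = inj₁ e⊆I
    ... | inj₂ (v , v∈e∩∁I) with v∈e , v∈∁I ← x∈p∩q⁻ e (∁ I) v∈e∩∁I =
      inj₂ (v , v∈∁I , ⁅x⁆∪p⊆q v∈e W⊆e)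

  codegree<2℘ : ∀ {W I i} → ∣ I ∣ ≡ i → i < n →
    (∀ {v} → v ∈ ∁ I → codegree (⁅ v ⁆ ∪ W) * (2 * n) < codegree W) →
    codegree W < 2 * ℘ F i
  codegree<2℘ {W} {I} {i} ∣I∣≡i i<n light =
    average⇒<2* {S = S} 0<∣∁I∣ (∣p∣≤n (∁ I)) codegree≤℘+S ∣∁I∣+S*2n≤∣∁I∣*codegree
    where
    f : Fin n → ℕ
    f v = codegree (⁅ v ⁆ ∪ W)
    S : ℕ
    S = sumOver (∁ I) f
    0<∣∁I∣ : 0 < ∣ ∁ I ∣
    0<∣∁I∣ = subst (0 <_) (sym (∣∁p∣≡n∸∣p∣ I)) (m<n⇒0<n∸m (subst (_< n) (sym ∣I∣≡i) i<n))
    codegree≤℘+S : codegree W ≤ ℘ F i + S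
    codegree≤℘+S = ≤-trans (codegree-≤-inside+∑outside W I) (+-monoˡ-≤ S (edgesInside≤℘ F ∣I∣≡i))
    ∣∁I∣+S*2n≤∣∁I∣*codegree : ∣ ∁ I ∣ + S * (2 * n) ≤ ∣ ∁ I ∣ * codegree W
    ∣∁I∣+S*2n≤∣∁I∣*codegree = begin
      ∣ ∁ I ∣ + S * (2 * n)                        ≡⟨ cong (∣ ∁ I ∣ +_) (sumOver-*ʳ (∁ I) f (2 * n)) ⟨
      ∣ ∁ I ∣ + sumOver (∁ I) (λ v → f v * (2 * n)) ≡⟨ sumOver-suc (∁ I) (λ v → f v * (2 * n)) ⟨
      sumOver (∁ I) (λ v → suc (f v * (2 * n)))     ≤⟨ sumOver-mono-≤ (∁ I) light ⟩
      sumOver (∁ I) (λ _ → codegree W)             ≡⟨ sumOver-const (∁ I) (codegree W) ⟩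
      ∣ ∁ I ∣ * codegree W                         ∎
      where open ≤-Reasoning

module _ (F : Hypergraph n) {s i} (i<n : i < n) (dense : ℘ F i * (2 ^ s * n ^ (s ∸ 1)) ≤ ∣ F ∣ₑ) where

  heavy? : ∀ W → Decidable (λ v → codegree F W ≤ codegree F (⁅ v ⁆ ∪ W) * (2 * n))
  heavy? W v = codegree F W ≤? codegree F (⁅ v ⁆ ∪ W) * (2 * n)

  i≤∣heavy∣ : ∀ {W l} → suc l ≤ s → ∣ F ∣ₑ ≤ codegree F W * (2 * n) ^ l → i ≤ ∣ subsetOf (heavy? W) ∣
  i≤∣heavy∣ {W} l<s ∣F∣≤ = ≮⇒≥ λ ∣heavy∣<i →
    let I , heavy⊆I , ∣I∣≡i = superset-of-size (subsetOf (heavy? W)) (<⇒≤ ∣heavy∣<i) (<⇒≤ i<n)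
        light : ∀ {v} → v ∈ ∁ I → codegree F (⁅ v ⁆ ∪ W) * (2 * n) < codegree F W
        light v∈∁I = ≰⇒> λ heavy → x∈∁p⇒x∉p v∈∁I (heavy⊆I (∈-subsetOf⁺ (heavy? W) heavy))
    in <⇒≱ (level-bound {p = ℘ F i} (≤-trans (s≤s z≤n) i<n) l<s ∣F∣≤ (codegree<2℘ F ∣I∣≡i i<n light)) dense

  -- k coordinates of the tuple remain to be chosen.
  Heavy : ℕ → Subset n → Set
  Heavy k W = k ≤ s × ∣ F ∣ₑ ≤ codegree F W * (2 * n) ^ (s ∸ k)

  heavy-branch : ∀ {k W} → Heavy (suc k) W →
    Σ (List (Fin n)) λ vs → Unique vs × i ≤ length vs × All (λ v → Heavy k (⁅ v ⁆ ∪ W)) vs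
  heavy-branch {k} {W} (k<s , ∣F∣≤) =
    elements H , elements-unique H ,
    ≤-trans (i≤∣heavy∣ 1+l≤s ∣F∣≤) (≤-reflexive (sym (length-elements H))) ,
    All.map (λ v∈H → <⇒≤ k<s , grow (∈-subsetOf⁻ (heavy? W) v∈H)) (elements-⊆ H)
    where
    H : Subset n
    H = subsetOf (heavy? W)
    l : ℕ
    l = s ∸ suc k
    s∸k≡1+l : s ∸ k ≡ suc l
    s∸k≡1+l = +-∸-assoc 1 k<s
    1+l≤s : suc l ≤ s
    1+l≤s = subst (_≤ s) s∸k≡1+l (m∸n≤m s k)
    grow : ∀ {v} → codegree F W ≤ codegree F (⁅ v ⁆ ∪ W) * (2 * n) →
           ∣ F ∣ₑ ≤ codegree F (⁅ v ⁆ ∪ W) * (2 * n) ^ (s ∸ k)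
    grow {v} heavy = begin
      ∣ F ∣ₑ                                           ≤⟨ ∣F∣≤ ⟩
      codegree F W * (2 * n) ^ l                       ≤⟨ *-monoˡ-≤ _ heavy ⟩
      codegree F (⁅ v ⁆ ∪ W) * (2 * n) * (2 * n) ^ l    ≡⟨ *-assoc (codegree F (⁅ v ⁆ ∪ W)) _ _ ⟩
      codegree F (⁅ v ⁆ ∪ W) * (2 * n) ^ suc l          ≡⟨ cong (λ e → codegree F (⁅ v ⁆ ∪ W) * (2 * n) ^ e) s∸k≡1+l ⟨
      codegree F (⁅ v ⁆ ∪ W) * (2 * n) ^ (s ∸ k)        ∎
      where open ≤-Reasoning

lemma2p3 : (s : ℕ) → 1 ≤ s → (n : ℕ) → (F : Hypergraph n) → (i : ℕ) → 0 < i → i < n →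
    ℘ F i * (2 ^ s * n ^ (s ∸ 1)) ≤ ∣ F ∣ₑ →
    Σ (List (Vec (Fin n) s)) λ Us →
      Unique Us × i ^ s ≤ length Us ×
      All (λ U → ∣ F ∣ₑ ≤ ∣link∣ F (vertexSet U) * (2 * n) ^ s) Us
lemma2p3 s _ n F i _ i<n dense =
  let Us , Us! , i^s≤∣Us∣ , heavy = tuples (Heavy F i<n dense) (heavy-branch F i<n dense) s (≤-refl , start)
  in Us , Us! , i^s≤∣Us∣ ,
     All.map (λ {U} (_ , ∣F∣≤) → subst (λ c → ∣ F ∣ₑ ≤ c * (2 * n) ^ s) (codegree≡∣link∣ U) ∣F∣≤) heavy
  where
  start : ∣ F ∣ₑ ≤ codegree F ⊥ * (2 * n) ^ (s ∸ s)
  start = ≤-reflexive (sym (begin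
    codegree F ⊥ * (2 * n) ^ (s ∸ s) ≡⟨ cong (λ e → codegree F ⊥ * (2 * n) ^ e) (n∸n≡0 s) ⟩
    codegree F ⊥ * 1                 ≡⟨ *-identityʳ _ ⟩
    codegree F ⊥                     ≡⟨ codegree-⊥ F ⟩
    ∣ F ∣ₑ                           ∎))
    where open ≡-Reasoning
  codegree≡∣link∣ : ∀ U → codegree F (vertexSet U ∪ ⊥) ≡ ∣link∣ F (vertexSet U)
  codegree≡∣link∣ U = trans (cong (codegree F) (∪-identityʳ (vertexSet U))) (sym (∣link∣≡codegree F (vertexSet U)))
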